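{- Let $k\ge 1$ and $p\ge 1$ be integers, let $R$ be a set of $k$ nodes, and let $D_1,\dots,D_p$ be directed acyclic graphs on node set $R$. For each $i$, let $G_i$ be the connectivity-shift graph of $D_i$, with node set $R\cup R_i$ where $R_i$ is the copy of $R$ used for $G_i$, the sets $R_1,\dots,R_p$ being pairwise disjoint and disjoint from $R$. Let $G$ be the undirected graph obtained as the union of $G_1,\dots,G_p$ (so that the common set $R$ is identified across all gadgets); $G$ has $k(p+1)$ nodes. Then $G$ is $k$-connected.
   Context: The connectivity-shift graph of a digraph $D=(R,A)$ is the undirected graph on node set $R\cup R'$, where $R'=\{v':v\in R\}$ is a disjoint copy of $R$, whose edges are: the edge $uv'$ for every arc $uv\in A$; all edges of a clique on $R$; all edges of a clique on $R'$; and the matching $\{vv':v\in R\}$. An undirected graph $G=(V,E)$ is $k$-connected if for all $(s,t)\in V\times V$ the maximum number of internally-disjoint $st$-paths in $G$ is at least $k$. -}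

module Defs where

open import Data.Nat using (ℕ)
open import Data.Fin using (Fin)
open import Data.Sum using (_⊎_; inj₁; inj₂)
open import Data.Product using (_×_; _,_; Σ)
open import Data.List using (List; []; _∷_; _++_; [_])
open import Data.List.Relation.Unary.Linked using (Linked)
open import Data.List.Relation.Unary.Unique.Propositional using (Unique)
open import Data.List.Membership.Propositional using (_∈_)
open import Data.Empty using (⊥)
open import Relation.Nullary using (¬_)
open import Relation.Binary.PropositionalEquality using (_≡_; _≢_)

Digraph : ℕ → Set₁
Digraph k = Fin k → Fin k → Set

Acyclic : ∀ {k} → Digraph k → Set
Acyclic {k} A = (v : Fin k) (xs : List (Fin k)) → ¬ Linked A (v ∷ xs ++ [ v ])

record Path {V : Set} (E : V → V → Set) (s t : V) : Set where
  field
    inner    : List V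
    adjacent : Linked E (s ∷ inner ++ [ t ])
    distinct : Unique (s ∷ inner ++ [ t ])
open Path public

InternallyDisjoint : ∀ {V : Set} {E : V → V → Set} {s t : V} →
                     Path E s t → Path E s t → Set
InternallyDisjoint {V} P Q = (x : V) → x ∈ inner P → x ∈ inner Q → ⊥

KConnected : ∀ {V : Set} → (V → V → Set) → ℕ → Set
KConnected {V} E k =
  (s t : V) → s ≢ t →
  Σ (Fin k → Path E s t) λ P →
    (i j : Fin k) → i ≢ j →
      (inner (P i) ≢ inner (P j)) × InternallyDisjoint (P i) (P j)

-- Connectivity-shift graph of a digraph D on R = Fin k.
-- Nodes: inj₁ v = v ∈ R, inj₂ v = v' ∈ R'.

data CSBase {k : ℕ} (D : Digraph k) : Fin k ⊎ Fin k → Fin k ⊎ Fin k → Set where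
  arc     : ∀ {u v} → D u v → CSBase D (inj₁ u) (inj₂ v)
  cliqueR : ∀ {u v} → u ≢ v → CSBase D (inj₁ u) (inj₁ v)
  cliqueR' : ∀ {u v} → u ≢ v → CSBase D (inj₂ u) (inj₂ v)
  match   : ∀ {v} → CSBase D (inj₁ v) (inj₂ v)

CSEdge : ∀ {k} → Digraph k → Fin k ⊎ Fin k → Fin k ⊎ Fin k → Set
CSEdge D x y = CSBase D x y ⊎ CSBase D y x

-- Union of G_1..G_p: node set R ∪ R_1 ∪ … ∪ R_p, with R shared.
-- inj₁ v = v ∈ R ; inj₂ (i , v) = copy of v in R_i.

UNode : ℕ → ℕ → Set
UNode k p = Fin k ⊎ (Fin p × Fin k)

embed : ∀ {k p} → Fin p → Fin k ⊎ Fin k → UNode k p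
embed i (inj₁ v) = inj₁ v
embed i (inj₂ v) = inj₂ (i , v)

data UnionEdge {k p : ℕ} (D : Fin p → Digraph k) : UNode k p → UNode k p → Set where
  fromGadget : (i : Fin p) {x y : Fin k ⊎ Fin k} →
               CSEdge (D i) x y → UnionEdge D (embed i x) (embed i y)

{-# OPTIONS --safe #-}
module Submission where

open import Defs
open import Data.Nat using (ℕ; _≤_)
open import Data.Fin using (Fin; _≟_; fromℕ<)
open import Data.Sum using (_⊎_; inj₁; inj₂)
open import Data.Product using (_×_; _,_; Σ)
open import Data.List using ([]; _∷_)
open import Data.List.Relation.Unary.Linked using ([-]; _∷_)
open import Data.List.Relation.Unary.All as All using (All; []; _∷_)
open import Data.List.Relation.Unary.AllPairs using ([]; _∷_)
open import Data.List.Relation.Unary.Any using (here)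
open import Data.List.Membership.Propositional using (_∈_)
open import Function using (_∘_)
open import Relation.Nullary using (yes; no)
open import Relation.Binary.PropositionalEquality
  using (_≡_; _≢_; refl; sym; trans; cong; subst; ≢-sym)

-- Only the cliques and the matchings are used: neither the arcs (hence acyclicity)
-- nor k ≥ 1 matter, while p ≥ 1 provides a gadget for the detour between two nodes
-- of R.  For fixed s ≠ t every node gets an owner u ∈ R and the u-th s-t path has
-- all its internal nodes owned by u, so the k paths are internally disjoint.
-- Usually v and all its copies are owned by v, and the u-th path detours through u
-- or its copies; when s and t lie on the same side (both in R, or both in one R_i)
-- the whole other side is owned by a single path instead.

DisjointPaths : {V : Set} → (V → V → Set) → ℕ → V → V → Set
DisjointPaths E k s t =
  Σ (Fin k → Path E s t) λ P →
    (i j : Fin k) → i ≢ j →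
      (inner (P i) ≢ inner (P j)) × InternallyDisjoint (P i) (P j)

module ShortPaths {V : Set} {E : V → V → Set}
                  (irreflexive : ∀ {x y} → E x y → x ≢ y) where

  path₁ : ∀ {s t} → E s t → Path E s t
  path₁ e = record
    { inner    = []
    ; adjacent = e ∷ [-]
    ; distinct = (irreflexive e ∷ []) ∷ [] ∷ []
    }

  path₂ : ∀ {s a t} → E s a → E a t → s ≢ t → Path E s t
  path₂ {a = a} e₁ e₂ s≢t = record
    { inner    = a ∷ []
    ; adjacent = e₁ ∷ e₂ ∷ [-]
    ; distinct = (irreflexive e₁ ∷ s≢t ∷ []) ∷ (irreflexive e₂ ∷ []) ∷ [] ∷ []
    }

  path₃ : ∀ {s a b t} → E s a → E a b → E b t →
          s ≢ b → s ≢ t → a ≢ t → Path E s t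
  path₃ {a = a} {b} e₁ e₂ e₃ s≢b s≢t a≢t = record
    { inner    = a ∷ b ∷ []
    ; adjacent = e₁ ∷ e₂ ∷ e₃ ∷ [-]
    ; distinct = (irreflexive e₁ ∷ s≢b ∷ s≢t ∷ [])
               ∷ (irreflexive e₂ ∷ a≢t ∷ [])
               ∷ (irreflexive e₃ ∷ [])
               ∷ [] ∷ []
    }

  path₄ : ∀ {s a b c t} → E s a → E a b → E b c → E c t →
          s ≢ b → s ≢ c → s ≢ t → a ≢ c → a ≢ t → b ≢ t → Path E s t
  path₄ {a = a} {b} {c} e₁ e₂ e₃ e₄ s≢b s≢c s≢t a≢c a≢t b≢t = record
    { inner    = a ∷ b ∷ c ∷ []
    ; adjacent = e₁ ∷ e₂ ∷ e₃ ∷ e₄ ∷ [-]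
    ; distinct = (irreflexive e₁ ∷ s≢b ∷ s≢c ∷ s≢t ∷ [])
               ∷ (irreflexive e₂ ∷ a≢c ∷ a≢t ∷ [])
               ∷ (irreflexive e₃ ∷ b≢t ∷ [])
               ∷ (irreflexive e₄ ∷ [])
               ∷ [] ∷ []
    }

record OwnedPath {V : Set} (E : V → V → Set) {k : ℕ} (owner : V → Fin k)
                 (direct : Fin k) (s t : V) (u : Fin k) : Set where
  constructor ownedPath
  field
    path            : Path E s t
    owned           : All (λ x → owner x ≡ u) (inner path)
    direct-if-empty : inner path ≡ [] → u ≡ direct
open OwnedPath

owned⇒disjoint : ∀ {V : Set} {E : V → V → Set} {k s t} (owner : V → Fin k) direct →
                 (∀ u → OwnedPath E owner direct s t u) → DisjointPaths E k s t
owned⇒disjoint owner direct P = path ∘ P , λ i j i≢j →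
  innersDistinct i j i≢j , internallyDisjoint i j i≢j
  where
  internallyDisjoint : ∀ i j → i ≢ j → InternallyDisjoint (path (P i)) (path (P j))
  internallyDisjoint i j i≢j x x∈Pi x∈Pj =
    i≢j (trans (sym (All.lookup (owned (P i)) x∈Pi)) (All.lookup (owned (P j)) x∈Pj))

  innersDistinct : ∀ i j → i ≢ j → inner (path (P i)) ≢ inner (path (P j))
  innersDistinct i j i≢j eq with inner (path (P i)) in Pi
  ... | []     = i≢j (trans (direct-if-empty (P i) Pi) (sym (direct-if-empty (P j) (sym eq))))
  ... | x ∷ xs = internallyDisjoint i j i≢j x (subst (x ∈_) (sym Pi) (here refl))
                                              (subst (x ∈_) eq (here refl))

pattern base v   = inj₁ v
pattern copy i v = inj₂ (i , v)

module _ {k : ℕ} {D : Digraph k} where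

  csBase-irreflexive : ∀ {x y} → CSBase D x y → x ≢ y
  csBase-irreflexive (arc _)          ()
  csBase-irreflexive (cliqueR u≢v)  refl = u≢v refl
  csBase-irreflexive (cliqueR' u≢v) refl = u≢v refl
  csBase-irreflexive match            ()

  csEdge-irreflexive : ∀ {x y} → CSEdge D x y → x ≢ y
  csEdge-irreflexive (inj₁ e) = csBase-irreflexive e
  csEdge-irreflexive (inj₂ e) = ≢-sym (csBase-irreflexive e)

embed-injective : ∀ {k p} (i : Fin p) {x y : Fin k ⊎ Fin k} →
                  embed i x ≡ embed i y → x ≡ y
embed-injective i {inj₁ _} {inj₁ _} refl = refl
embed-injective i {inj₂ _} {inj₂ _} refl = refl

unionEdge-irreflexive : ∀ {k p} {D : Fin p → Digraph k} {x y} → UnionEdge D x y → x ≢ y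
unionEdge-irreflexive (fromGadget i e) = csEdge-irreflexive e ∘ embed-injective i

module UnionGraph {k p : ℕ} (D : Fin p → Digraph k) (i₀ : Fin p) where

  E : UNode k p → UNode k p → Set
  E = UnionEdge D

  open ShortPaths (unionEdge-irreflexive {D = D})

  base-base : ∀ {a b} → a ≢ b → E (base a) (base b)
  base-base a≢b = fromGadget i₀ {inj₁ _} {inj₁ _} (inj₁ (cliqueR a≢b))

  base-copy : ∀ {i a} → E (base a) (copy i a)
  base-copy {i} = fromGadget i {inj₁ _} {inj₂ _} (inj₁ match)

  copy-base : ∀ {i a} → E (copy i a) (base a)
  copy-base {i} = fromGadget i {inj₂ _} {inj₁ _} (inj₂ match)

  copy-copy : ∀ {i a b} → a ≢ b → E (copy i a) (copy i b)
  copy-copy {i} a≢b = fromGadget i {inj₂ _} {inj₂ _} (inj₁ (cliqueR' a≢b))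

  gadget≢⇒copy≢ : ∀ {i j : Fin p} {a b : Fin k} → i ≢ j →
                  _≢_ {A = UNode k p} (copy i a) (copy j b)
  gadget≢⇒copy≢ i≢j refl = i≢j refl

  coordinate : UNode k p → Fin k
  coordinate (base v)   = v
  coordinate (copy _ v) = v

  collapseBase : Fin k → UNode k p → Fin k
  collapseBase v (base _)   = v
  collapseBase _ (copy _ x) = x

  collapseCopies : Fin k → UNode k p → Fin k
  collapseCopies _ (base x)   = x
  collapseCopies v (copy _ _) = v

  base-to-base : ∀ {v w} → v ≢ w → ∀ u → OwnedPath E (collapseCopies v) w (base v) (base w) u
  base-to-base {v} {w} v≢w u with u ≟ v | u ≟ w
  ... | yes refl | _        = ownedPath
    (path₃ (base-copy {i₀}) (copy-copy v≢w) copy-base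
           (λ ()) (v≢w ∘ cong coordinate) (λ ()))
    (refl ∷ refl ∷ []) λ ()
  ... | no _     | yes refl = ownedPath (path₁ (base-base v≢w)) [] λ _ → refl
  ... | no u≢v   | no u≢w   = ownedPath
    (path₂ (base-base (≢-sym u≢v)) (base-base u≢w) (v≢w ∘ cong coordinate))
    (refl ∷ []) λ ()

  base-to-copy : ∀ {i} v w u → OwnedPath E coordinate v (base w) (copy i v) u
  base-to-copy v w u with u ≟ v | u ≟ w
  ... | yes refl | yes refl = ownedPath (path₁ base-copy) [] λ _ → refl
  ... | yes refl | no u≢w   = ownedPath
    (path₂ (base-base (≢-sym u≢w)) base-copy (λ ())) (refl ∷ []) λ ()
  ... | no u≢v   | yes refl = ownedPath
    (path₂ base-copy (copy-copy u≢v) (λ ())) (refl ∷ []) λ ()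
  ... | no u≢v   | no u≢w   = ownedPath
    (path₃ (base-base (≢-sym u≢w)) base-copy (copy-copy u≢v) (λ ()) (λ ()) (λ ()))
    (refl ∷ refl ∷ []) λ ()

  copy-to-base : ∀ {i} v w u → OwnedPath E coordinate v (copy i v) (base w) u
  copy-to-base v w u with u ≟ v | u ≟ w
  ... | yes refl | yes refl = ownedPath (path₁ copy-base) [] λ _ → refl
  ... | yes refl | no u≢w   = ownedPath
    (path₂ copy-base (base-base u≢w) (λ ())) (refl ∷ []) λ ()
  ... | no u≢v   | yes refl = ownedPath
    (path₂ (copy-copy (≢-sym u≢v)) copy-base (λ ())) (refl ∷ []) λ ()
  ... | no u≢v   | no u≢w   = ownedPath
    (path₃ (copy-copy (≢-sym u≢v)) copy-base (base-base u≢w) (λ ()) (λ ()) (λ ()))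
    (refl ∷ refl ∷ []) λ ()

  copy-to-copy-same : ∀ {i v w} → v ≢ w → ∀ u →
                      OwnedPath E (collapseBase v) w (copy i v) (copy i w) u
  copy-to-copy-same {v = v} {w} v≢w u with u ≟ v | u ≟ w
  ... | yes refl | _        = ownedPath
    (path₃ copy-base (base-base v≢w) base-copy (λ ()) (v≢w ∘ cong coordinate) (λ ()))
    (refl ∷ refl ∷ []) λ ()
  ... | no _     | yes refl = ownedPath (path₁ (copy-copy v≢w)) [] λ _ → refl
  ... | no u≢v   | no u≢w   = ownedPath
    (path₂ (copy-copy (≢-sym u≢v)) (copy-copy u≢w) (v≢w ∘ cong coordinate))
    (refl ∷ []) λ ()

  copy-to-copy-across : ∀ {i j} v w → i ≢ j → ∀ u →
                        OwnedPath E coordinate v (copy i v) (copy j w) u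
  copy-to-copy-across v w i≢j u with u ≟ v | u ≟ w
  ... | yes refl | yes refl = ownedPath
    (path₂ copy-base base-copy (gadget≢⇒copy≢ i≢j)) (refl ∷ []) λ ()
  ... | yes refl | no u≢w   = ownedPath
    (path₃ copy-base base-copy (copy-copy u≢w)
           (gadget≢⇒copy≢ i≢j) (gadget≢⇒copy≢ i≢j) (λ ()))
    (refl ∷ refl ∷ []) λ ()
  ... | no u≢v   | yes refl = ownedPath
    (path₃ (copy-copy (≢-sym u≢v)) copy-base base-copy
           (λ ()) (gadget≢⇒copy≢ i≢j) (gadget≢⇒copy≢ i≢j))
    (refl ∷ refl ∷ []) λ ()
  ... | no u≢v   | no u≢w   = ownedPath
    (path₄ (copy-copy (≢-sym u≢v)) copy-base base-copy (copy-copy u≢w)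
           (λ ()) (gadget≢⇒copy≢ i≢j) (gadget≢⇒copy≢ i≢j)
           (gadget≢⇒copy≢ i≢j) (gadget≢⇒copy≢ i≢j) (λ ()))
    (refl ∷ refl ∷ refl ∷ []) λ ()

  k-connected : KConnected E k
  k-connected (base v) (base w) s≢t =
    owned⇒disjoint (collapseCopies v) w (base-to-base (s≢t ∘ cong base))
  k-connected (base w) (copy i v) _ = owned⇒disjoint coordinate v (base-to-copy v w)
  k-connected (copy i v) (base w) _ = owned⇒disjoint coordinate v (copy-to-base v w)
  k-connected (copy i v) (copy j w) s≢t with i ≟ j
  ... | yes refl = owned⇒disjoint (collapseBase v) w (copy-to-copy-same (s≢t ∘ cong (copy i)))
  ... | no i≢j   = owned⇒disjoint coordinate v (copy-to-copy-across v w i≢j)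

lemma2 : (k p : ℕ) → 1 ≤ k → 1 ≤ p →
    (D : Fin p → Digraph k) → ((i : Fin p) → Acyclic (D i)) →
    KConnected (UnionEdge D) k
lemma2 k p _ 1≤p D _ = UnionGraph.k-connected D (fromℕ< 1≤p)
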